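{- Let $n\ge2$, $\mathsf u\in\mathcal S_n$ and $0\le j<n(n-1)$. If $u_{(j)}s_j<u_{(j)}$ in weak order (i.e. the Coxeter length of $u_{(j)}s_j$ is smaller than that of $u_{(j)}$), then $u_{j+1}=s_j$.
   Context: $\widetilde S_n$ is the affine symmetric group (bijections $w:\mathbb Z\to\mathbb Z$ with $w(i+n)=w(i)+n$ and $\sum_{i=1}^n w(i)=\binom{n+1}{2}$, multiplied by composition), a Coxeter group with simple reflections $s_0,\dots,s_{n-1}$, where $s_j$ interchanges $j+kn$ and $j+1+kn$ for all $k$ (index mod $n$). $\boldsymbol\lambda_n$ is the word $[s_0,\dots,s_{n-1}]$ repeated $n-1$ times; its $j$-th letter ($1\le j\le n(n-1)$) is $s_{j-1}$. A subword is $\mathsf u=[u_1,\dots,u_{n(n-1)}]$ with each $u_j$ either the $j$-th letter or the identity $e$ (a skip); $u_{(j)}=u_1\cdots u_j$ with $u_{(0)}=e$. $\mathcal S_n$ is the set of subwords with exactly $2n-2$ skips and $u_{(n(n-1))}=e$. -}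

module Defs where

open import Data.Nat using (ℕ; zero; suc; _∸_; _<_; _*_)
open import Data.Integer using (ℤ; +_; _+_; _-_)
open import Data.Integer.DivMod using (_%ℕ_)
open import Data.Bool using (Bool; true; false; if_then_else_)
open import Data.Nat using (_≡ᵇ_)
open import Data.List using (List; []; _∷_; length; take)
open import Data.Vec using (Vec; toList)
open import Data.Product using (Σ; _×_)
open import Relation.Binary.PropositionalEquality using (_≡_)
open import Function using (_∘_; id)

-- Elements of the affine symmetric group are bijections ℤ → ℤ; all elements
-- occurring here are products of simple reflections, so we represent them as
-- functions ℤ → ℤ, with group product = composition and equality = pointwise.

-- The simple reflection s_j of the affine symmetric group S̃_n (index j mod n):
-- interchanges j + kn and j + 1 + kn for all k.  (Only meaningful for n ≥ 2.)
sref : ℕ → ℕ → ℤ → ℤ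
sref zero    j i = i
sref (suc m) j i =
  let d = (i - + j) %ℕ suc m in
  if d ≡ᵇ 0 then i + + 1 else (if d ≡ᵇ 1 then i - + 1 else i)

_≈ₐ_ : (ℤ → ℤ) → (ℤ → ℤ) → Set
f ≈ₐ g = ∀ i → f i ≡ g i

wordProd : ℕ → List ℕ → ℤ → ℤ
wordProd n []       = id
wordProd n (a ∷ ws) = sref n a ∘ wordProd n ws

IsCoxLength : ℕ → (ℤ → ℤ) → ℕ → Set
IsCoxLength n w k =
  Σ (List ℕ) (λ ws → (length ws ≡ k) × (wordProd n ws ≈ₐ w))
  × (∀ (ws : List ℕ) → wordProd n ws ≈ₐ w → k Data.Nat.≤ length ws)

_<ℓ[_]_ : (ℤ → ℤ) → ℕ → (ℤ → ℤ) → Set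
x <ℓ[ n ] y = Σ ℕ (λ a → Σ ℕ (λ b → IsCoxLength n x a × IsCoxLength n y b × a < b))

-- A subword of λ_n is encoded by a vector of booleans of length n(n-1):
-- position p (0-indexed) is true if the letter s_p (= s_{p mod n}) is kept,
-- false if it is replaced by the identity e (a skip).
subProd : ℕ → ℕ → List Bool → ℤ → ℤ
subProd n p []           = id
subProd n p (true ∷ bs)  = sref n p ∘ subProd n (suc p) bs
subProd n p (false ∷ bs) = subProd n (suc p) bs

prefixProd : (n : ℕ) → Vec Bool (n * (n ∸ 1)) → ℕ → ℤ → ℤ
prefixProd n u j = subProd n 0 (take j (toList u))

skips : List Bool → ℕ
skips []           = 0
skips (true ∷ bs)  = skips bs
skips (false ∷ bs) = suc (skips bs)

InS : (n : ℕ) → Vec Bool (n * (n ∸ 1)) → Set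
InS n u = (skips (toList u) ≡ 2 * n ∸ 2) × (prefixProd n u (n * (n ∸ 1)) ≈ₐ id)

-- Write u₍ₜ₎ for the prefix products of the subword and put horiz t = u₍ₜ₎(t),
-- vert t = u₍ₜ₎(t + 1); it suffices to show horiz t < vert t at every skip t, since then
-- u₍ₜ₎ has an ascent at t and the exchange property (a reduced word of u₍ₜ₎sₜ, which has a
-- descent at t, loses a letter when multiplied by sₜ) shows that u₍ₜ₎sₜ is not shorter.
--
-- Cut the N = n(n-1) positions into n rows of m = n - 1, so that t + m lies below t.
-- Periodicity u(x + n) = u(x) + n turns the prefix products into a pipe dream: a kept letter
-- passes horiz on to t + 1 and vert, raised by n, down to t + m, while a skip exchanges the
-- two roles.  Since u₍₀₎ = u₍N₎ = e, the values entering a column from above and leaving it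
-- below are known, so every column contains a skip, and in fact two: a lone skip would give
-- vert = horiz + n in its cell, impossible for a bijection.  With 2n - 2 = 2m skips in all,
-- every column has exactly two.  Along a column the values are now explicit, and induction
-- forwards, resp. backwards, over the positions gives horiz t < threshold t, resp.
-- threshold t < horiz (t + 1) + n, for threshold t = t + 1 + ⌊t/m⌋.  At the upper skip of a
-- column vert t = threshold t, at the lower one horiz t + n = threshold t and
-- horiz (t + 1) = vert t; either way horiz t < vert t.

module Submission where

open import Defs
open import Data.Nat using (ℕ; zero; suc)
open import Data.Bool using (Bool; false)
open import Data.List using (List; []; _∷_)

module Counting where
  open import Data.Nat
  open import Data.Nat.Properties
  open import Data.Bool using (Bool; true; false; if_then_else_)
  open import Data.Product using (Σ-syntax; _×_; _,_; proj₁; proj₂; map₁; map₂)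
  open import Data.Sum using (inj₁; inj₂)
  open import Data.Empty using (⊥-elim)
  open import Relation.Nullary using (¬_)
  open import Data.Nat.Induction using (<-rec)
  open import Relation.Binary.PropositionalEquality
  open import Algebra.Properties.CommutativeSemigroup +-commutativeSemigroup using (interchange)

  sumTo : ℕ → (ℕ → ℕ) → ℕ
  sumTo zero    g = 0
  sumTo (suc n) g = g n + sumTo n g

  sumTo-+ : ∀ a b g → sumTo (a + b) g ≡ sumTo b (λ i → g (a + i)) + sumTo a g
  sumTo-+ a zero    g = cong (λ x → sumTo x g) (+-identityʳ a)
  sumTo-+ a (suc b) g = begin
    sumTo (a + suc b) g                                     ≡⟨ cong (λ x → sumTo x g) (+-suc a b) ⟩
    g (a + b) + sumTo (a + b) g                             ≡⟨ cong (g (a + b) +_) (sumTo-+ a b g) ⟩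
    g (a + b) + (sumTo b (λ i → g (a + i)) + sumTo a g)     ≡⟨ +-assoc (g (a + b)) _ _ ⟨
    sumTo (suc b) (λ i → g (a + i)) + sumTo a g             ∎
    where open ≡-Reasoning

  sumTo-+-distrib : ∀ n g h → sumTo n (λ i → g i + h i) ≡ sumTo n g + sumTo n h
  sumTo-+-distrib zero    g h = refl
  sumTo-+-distrib (suc n) g h = begin
    g n + h n + sumTo n (λ i → g i + h i)   ≡⟨ cong (g n + h n +_) (sumTo-+-distrib n g h) ⟩
    g n + h n + (sumTo n g + sumTo n h)     ≡⟨ interchange (g n) (h n) (sumTo n g) (sumTo n h) ⟩
    g n + sumTo n g + (h n + sumTo n h)     ∎
    where open ≡-Reasoning

  sumTo-rows : ∀ m r g → sumTo (r * m) g ≡ sumTo m (λ c → sumTo r (λ i → g (i * m + c)))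
  sumTo-rows m zero    g = sym (sumTo-zero m)
    where
      sumTo-zero : ∀ m → sumTo m (λ _ → 0) ≡ 0
      sumTo-zero zero    = refl
      sumTo-zero (suc m) = sumTo-zero m
  sumTo-rows m (suc r) g = begin
    sumTo (m + r * m) g                                   ≡⟨ cong (λ x → sumTo x g) (+-comm m (r * m)) ⟩
    sumTo (r * m + m) g                                   ≡⟨ sumTo-+ (r * m) m g ⟩
    sumTo m last-row + sumTo (r * m) g                    ≡⟨ cong (sumTo m last-row +_) (sumTo-rows m r g) ⟩
    sumTo m last-row + sumTo m columns                    ≡⟨ sumTo-+-distrib m last-row columns ⟨
    sumTo m (λ c → sumTo (suc r) (λ i → g (i * m + c)))   ∎
    where
      open ≡-Reasoning
      last-row columns : ℕ → ℕ
      last-row c = g (r * m + c)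
      columns  c = sumTo r (λ i → g (i * m + c))

  sumTo-lower-bound : ∀ m k g → (∀ i → i < m → k ≤ g i) → m * k ≤ sumTo m g
  sumTo-lower-bound zero    k g _   = z≤n
  sumTo-lower-bound (suc m) k g k≤g =
    +-mono-≤ (k≤g m ≤-refl) (sumTo-lower-bound m k g (λ i i<m → k≤g i (m<n⇒m<1+n i<m)))

  +-tight : ∀ {a b c d} → c ≤ a → d ≤ b → a + b ≡ c + d → a ≡ c × b ≡ d
  +-tight {a} {b} {c} {d} c≤a d≤b a+b≡c+d = a≡c , +-cancelˡ-≡ c b d (trans (cong (_+ b) (sym a≡c)) a+b≡c+d)
    where
      a≡c : a ≡ c
      a≡c = ≤-antisym (+-cancelʳ-≤ b a c (≤-trans (≤-reflexive a+b≡c+d) (+-monoʳ-≤ c d≤b))) c≤a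

  sumTo-tight : ∀ m k g → (∀ i → i < m → k ≤ g i) → sumTo m g ≡ m * k → ∀ i → i < m → g i ≡ k
  sumTo-tight (suc m) k g k≤g sum≡ i i<1+m with m≤n⇒m<n∨m≡n (s≤s⁻¹ i<1+m)
  ... | inj₁ i<m = sumTo-tight m k g k≤g′ rest≡ i i<m
    where
      k≤g′ : ∀ i → i < m → k ≤ g i
      k≤g′ i i<m = k≤g i (m<n⇒m<1+n i<m)
      rest≡ : sumTo m g ≡ m * k
      rest≡ = proj₂ (+-tight (k≤g m ≤-refl) (sumTo-lower-bound m k g k≤g′) sum≡)
  ... | inj₂ refl = proj₁ (+-tight (k≤g i ≤-refl) (sumTo-lower-bound i k g (λ j j<i → k≤g j (m<n⇒m<1+n j<i))) sum≡)

  #false : (ℕ → Bool) → ℕ → ℕ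
  #false f n = sumTo n (λ i → if f i then 0 else 1)

  AllTrue : (ℕ → Bool) → ℕ → ℕ → Set
  AllTrue f a b = ∀ i → a ≤ i → i < b → f i ≡ true

  module _ (f : ℕ → Bool) where

    #false-suc-false : ∀ i → f i ≡ false → #false f (suc i) ≡ suc (#false f i)
    #false-suc-false i fi≡false rewrite fi≡false = refl

    #false-mono : ∀ {a b} → a ≤ b → #false f a ≤ #false f b
    #false-mono {b = zero}  z≤n = z≤n
    #false-mono {b = suc b} a≤1+b with m≤n⇒m<n∨m≡n a≤1+b
    ... | inj₂ refl = ≤-refl
    ... | inj₁ a<1+b = ≤-trans (#false-mono (s≤s⁻¹ a<1+b)) (m≤n+m (#false f b) _)

    #false-≡⇒AllTrue : ∀ {a b} → a ≤ b → #false f a ≡ #false f b → AllTrue f a b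
    #false-≡⇒AllTrue {a} {suc b} a≤1+b #a≡#1+b i a≤i i<1+b with m≤n⇒m<n∨m≡n a≤1+b
    ... | inj₂ refl = ⊥-elim (<-irrefl refl (<-≤-trans i<1+b a≤i))
    ... | inj₁ a<1+b with f b in fb | m≤n⇒m<n∨m≡n (s≤s⁻¹ i<1+b)
    ...   | true  | inj₂ refl = fb
    ...   | true  | inj₁ i<b  = #false-≡⇒AllTrue (s≤s⁻¹ a<1+b) #a≡#1+b i a≤i i<b
    ...   | false | _         = ⊥-elim (<-irrefl #a≡#1+b (s≤s (#false-mono (s≤s⁻¹ a<1+b))))

    FirstFalse : ℕ → ℕ → Set
    FirstFalse a b = Σ[ i ∈ ℕ ] a ≤ i × i < b × f i ≡ false × #false f i ≡ #false f a

    first-false : ∀ {a b} → a ≤ b → #false f a < #false f b → FirstFalse a b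
    first-false {a} {suc b} a≤1+b #a<#1+b with m≤n⇒m<n∨m≡n a≤1+b
    ... | inj₂ refl = ⊥-elim (<-irrefl refl #a<#1+b)
    ... | inj₁ a<1+b with m≤n⇒m<n∨m≡n (#false-mono (s≤s⁻¹ a<1+b))
    ...   | inj₁ #a<#b = map₂ (map₂ (map₁ m<n⇒m<1+n)) (first-false (s≤s⁻¹ a<1+b) #a<#b)
    ...   | inj₂ #a≡#b with f b in fb
    ...     | false = b , s≤s⁻¹ a<1+b , ≤-refl , fb , sym #a≡#b
    ...     | true  = ⊥-elim (<-irrefl #a≡#b #a<#1+b)

    data FalseRole (n i : ℕ) : Set where
      first  : AllTrue f 0 i → (j : ℕ) → i < j → j < n → f j ≡ false → AllTrue f (suc i) j → FalseRole n i
      second : AllTrue f (suc i) n → (j : ℕ) → j < i → f j ≡ false → AllTrue f (suc j) i → FalseRole n i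

    false-role : ∀ {n i} → #false f n ≡ 2 → i < n → f i ≡ false → FalseRole n i
    false-role {n} {i} #n≡2 i<n fi with #false f i in #i | subst₂ _≤_ (#false-suc-false i fi) #n≡2 (#false-mono i<n)
    ... | 0 | _ with first-false i<n (subst₂ _<_ (sym (trans (#false-suc-false i fi) (cong suc #i))) (sym #n≡2) (n<1+n 1))
    ...   | j , 1+i≤j , j<n , fj , #j≡#1+i =
      first (#false-≡⇒AllTrue z≤n (sym #i)) j 1+i≤j j<n fj (#false-≡⇒AllTrue 1+i≤j (sym #j≡#1+i))
    false-role {n} {i} #n≡2 i<n fi | 1 | _ with first-false {0} {i} z≤n (subst (0 <_) (sym #i) z<s)
    ...   | j , _ , j<i , fj , #j≡0 =
      second (#false-≡⇒AllTrue i<n (trans (trans (#false-suc-false i fi) (cong suc #i)) (sym #n≡2)))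
             j j<i fj (#false-≡⇒AllTrue j<i (trans (#false-suc-false j fj) (trans (cong suc #j≡0) (sym #i))))
    false-role {n} {i} #n≡2 i<n fi | suc (suc _) | s≤s (s≤s ())

    2≤#false : ∀ {n} → ¬ AllTrue f 0 n → (∀ i → i < n → f i ≡ false → AllTrue f 0 i → ¬ AllTrue f (suc i) n) →
               2 ≤ #false f n
    2≤#false {n} not-all unique-false with #false f n in #n
    ... | 0           = ⊥-elim (not-all (#false-≡⇒AllTrue z≤n (sym #n)))
    ... | suc (suc _) = s≤s (s≤s z≤n)
    ... | 1 with first-false {0} {n} z≤n (subst (0 <_) (sym #n) z<s)
    ...   | j , _ , j<n , fj , #j≡0 = ⊥-elim (unique-false j j<n fj (#false-≡⇒AllTrue z≤n (sym #j≡0))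
        (#false-≡⇒AllTrue j<n (trans (#false-suc-false j fj) (trans (cong suc #j≡0) (sym #n)))))

    #false-shift : ∀ L → #false f (suc L) ≡ (if f 0 then 0 else 1) + #false (λ i → f (suc i)) L
    #false-shift L = begin
      #false f (1 + L)                                   ≡⟨ sumTo-+ 1 L _ ⟩
      #false (λ i → f (suc i)) L + (head + 0)            ≡⟨ cong (#false (λ i → f (suc i)) L +_) (+-identityʳ head) ⟩
      #false (λ i → f (suc i)) L + head                  ≡⟨ +-comm _ head ⟩
      head + #false (λ i → f (suc i)) L                  ∎
      where
        open ≡-Reasoning
        head : ℕ
        head = if f 0 then 0 else 1

  downward-rec : ∀ {ℓ} (P : ℕ → Set ℓ) {N} → (∀ t → t < N → (∀ t′ → t < t′ → t′ < N → P t′) → P t) →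
                 ∀ t → t < N → P t
  downward-rec P {N} step t = <-rec (λ d → ∀ t → N ∸ t ≡ d → t < N → P t) go (N ∸ t) t refl
    where
      go : ∀ d → (∀ {d′} → d′ < d → ∀ t → N ∸ t ≡ d′ → t < N → P t) → ∀ t → N ∸ t ≡ d → t < N → P t
      go _ smaller t refl t<N = step t t<N (λ t′ t<t′ t′<N → smaller (∸-monoʳ-< t<t′ (<⇒≤ t′<N)) t′ refl t′<N)

module Reflections (k : ℕ) where
  open import Data.Nat as ℕ using (ℕ; zero; suc; z≤n; s≤s)
  import Data.Nat.Properties as ℕ
  open import Data.Integer using (ℤ; +_; -[1+_]; _+_; _-_; _*_; -_; _<_; _≤_; +<+)
  open import Data.Integer.Properties
  open import Data.Integer.DivMod using (_%ℕ_; _/ℕ_; a≡a%ℕn+[a/ℕn]*n; n%ℕd<d)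
  open import Data.Integer.Tactic.RingSolver using (solve-∀)
  open import Data.Bool using (if_then_else_)
  open import Data.List using (List; []; _∷_; length)
  open import Data.Product using (Σ-syntax; _×_; _,_; proj₁; proj₂)
  open import Data.Empty using (⊥-elim)
  open import Function using (_∘_)
  open import Function.Definitions using (Injective)
  open import Relation.Nullary using (¬_)
  open import Relation.Binary.PropositionalEquality
  open import Relation.Binary.Definitions using (tri<; tri≈; tri>)

  n : ℕ
  n = suc (suc k)

  infix 4 _≡ₙ_
  -- A record rather than a Σ-type, so that x and y can be recovered by unification.
  record _≡ₙ_ (x y : ℤ) : Set where
    constructor _,_
    field
      quotient : ℤ
      proof    : x ≡ y + quotient * + n

  ≡ₙ-refl : ∀ {x} → x ≡ₙ x
  ≡ₙ-refl {x} = + 0 , sym (x+0*n≡x x (+ n))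
    where
      x+0*n≡x : ∀ x n → x + + 0 * n ≡ x
      x+0*n≡x = solve-∀

  ≡ₙ-sym : ∀ {x y} → x ≡ₙ y → y ≡ₙ x
  ≡ₙ-sym {x} {y} (q , x≡y+qn) = - q , sym (trans (cong (λ z → z + - q * + n) x≡y+qn) (cancel y q (+ n)))
    where
      cancel : ∀ y q n → y + q * n + - q * n ≡ y
      cancel = solve-∀

  ≡ₙ-trans : ∀ {x y z} → x ≡ₙ y → y ≡ₙ z → x ≡ₙ z
  ≡ₙ-trans {z = z} (p , x≡y+pn) (q , y≡z+qn) =
    q + p , trans x≡y+pn (trans (cong (λ y → y + p * + n) y≡z+qn) (regroup z q p (+ n)))
    where
      regroup : ∀ z q p n → z + q * n + p * n ≡ z + (q + p) * n
      regroup = solve-∀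

  ≡ₙ-+ʳ : ∀ {x y} z → x ≡ₙ y → x + z ≡ₙ y + z
  ≡ₙ-+ʳ {y = y} z (q , x≡y+qn) = q , trans (cong (_+ z) x≡y+qn) (swap y (q * + n) z)
    where
      swap : ∀ y a z → y + a + z ≡ y + z + a
      swap = solve-∀

  ≡ₙ-+n : ∀ x → x + + n ≡ₙ x
  ≡ₙ-+n x = + 1 , cong (_+_ x) (sym (*-identityˡ (+ n)))

  private
    n≤-residue : ∀ {r r′ q} → + r ≡ + r′ + + suc q * + n → n ℕ.≤ r
    n≤-residue {r} {r′} {q} r≡r′+qn = begin
      n                   ≤⟨ ℕ.m≤n*m n (suc q) ⟩
      suc q ℕ.* n         ≤⟨ ℕ.m≤n+m _ r′ ⟩
      r′ ℕ.+ suc q ℕ.* n  ≡⟨ +-injective (trans (cong (λ z → + r′ + z) (pos-* (suc q) n)) (sym r≡r′+qn)) ⟩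
      r                   ∎
      where open ℕ.≤-Reasoning

  residue-unique : ∀ {r r′} → r ℕ.< n → r′ ℕ.< n → + r ≡ₙ + r′ → r ≡ r′
  residue-unique r<n r′<n (+ zero , r≡r′+0) = +-injective (trans r≡r′+0 (+-identityʳ _))
  residue-unique r<n r′<n (+ suc q , r≡r′+qn) = ⊥-elim (ℕ.<⇒≱ r<n (n≤-residue {q = q} r≡r′+qn))
  residue-unique r<n r′<n (-[1+ q ] , r≡r′-qn) =
    ⊥-elim (ℕ.<⇒≱ r′<n (n≤-residue {q = q} (_≡ₙ_.proof (≡ₙ-sym (-[1+ q ] , r≡r′-qn)))))

  ≢ₙ-near : ∀ {t p} → t ℕ.< p → p ℕ.< t ℕ.+ n → ¬ + p ≡ₙ + t
  ≢ₙ-near {t} {p} t<p p<t+n p≡t = ℕ.<⇒≢ (ℕ.m<n⇒0<n∸m t<p) (sym (residue-unique d<n (s≤s z≤n) d≡0))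
    where
      p≡t+d : p ≡ t ℕ.+ (p ℕ.∸ t)
      p≡t+d = sym (ℕ.m+[n∸m]≡n (ℕ.<⇒≤ t<p))
      d<n : p ℕ.∸ t ℕ.< n
      d<n = ℕ.+-cancelˡ-< t _ _ (subst (ℕ._< t ℕ.+ n) p≡t+d p<t+n)
      cancel : ∀ t e → t + e - t ≡ e
      cancel = solve-∀
      d≡0 : + (p ℕ.∸ t) ≡ₙ + 0
      d≡0 = subst₂ _≡ₙ_ (trans (cong (λ q → + q - + t) p≡t+d) (cancel (+ t) (+ (p ℕ.∸ t)))) (+-inverseʳ (+ t))
                       (≡ₙ-+ʳ (- + t) p≡t)

  ≡ₙ-%ℕ : ∀ x → x ≡ₙ + (x %ℕ n)
  ≡ₙ-%ℕ x = x /ℕ n , a≡a%ℕn+[a/ℕn]*n x n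

  %ℕ-unique : ∀ {x r} → x ≡ₙ + r → r ℕ.< n → x %ℕ n ≡ r
  %ℕ-unique {x} x≡r r<n = residue-unique (n%ℕd<d x n) r<n (≡ₙ-trans (≡ₙ-sym (≡ₙ-%ℕ x)) x≡r)

  %ℕ-cong : ∀ {x y} → x ≡ₙ y → x %ℕ n ≡ y %ℕ n
  %ℕ-cong {y = y} x≡y = %ℕ-unique (≡ₙ-trans x≡y (≡ₙ-%ℕ y)) (n%ℕd<d y n)

  private
    displace : ℕ → ℤ → ℤ
    displace d y = if d ℕ.≡ᵇ 0 then y + + 1 else (if d ℕ.≡ᵇ 1 then y - + 1 else y)

    sref-displace : ∀ a y → sref n a y ≡ displace ((y - + a) %ℕ n) y
    sref-displace a y = refl

    displace-+ : ∀ d y z → displace d (y + z) ≡ displace d y + z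
    displace-+ zero          y z = +-swap y z (+ 1)
      where
        +-swap : ∀ y z c → y + z + c ≡ y + c + z
        +-swap = solve-∀
    displace-+ (suc zero)    y z = +-swap y z (+ 1)
      where
        +-swap : ∀ y z c → y + z - c ≡ y - c + z
        +-swap = solve-∀
    displace-+ (suc (suc d)) y z = refl

  Periodic : (ℤ → ℤ) → Set
  Periodic f = ∀ q y → f (y + q * + n) ≡ f y + q * + n

  sref-periodic : ∀ a → Periodic (sref n a)
  sref-periodic a q y = begin
    sref n a (y + q * + n)                            ≡⟨ sref-displace a (y + q * + n) ⟩
    displace ((y + q * + n - + a) %ℕ n) (y + q * + n) ≡⟨ cong (λ d → displace d (y + q * + n)) (%ℕ-cong same-residue) ⟩
    displace ((y - + a) %ℕ n) (y + q * + n)           ≡⟨ displace-+ ((y - + a) %ℕ n) y (q * + n) ⟩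
    displace ((y - + a) %ℕ n) y + q * + n             ≡⟨ cong (_+ q * + n) (sref-displace a y) ⟨
    sref n a y + q * + n                              ∎
    where
      open ≡-Reasoning
      shift : ∀ y q a n → y + q * n - a ≡ y - a + q * n
      shift = solve-∀
      same-residue : y + q * + n - + a ≡ₙ y - + a
      same-residue = q , shift y q (+ a) (+ n)

  private
    ≡ₙ-residue : ∀ y a → y ≡ₙ + a + + ((y - + a) %ℕ n)
    ≡ₙ-residue y a =
      subst₂ _≡ₙ_ (cancel y (+ a)) (+-comm (+ ((y - + a) %ℕ n)) (+ a)) (≡ₙ-+ʳ (+ a) (≡ₙ-%ℕ (y - + a)))
      where
        cancel : ∀ y a → y - a + a ≡ y
        cancel = solve-∀

    residue-of : ∀ {y a r} → y ≡ₙ + a + + r → r ℕ.< n → (y - + a) %ℕ n ≡ r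
    residue-of {y} {a} {r} y≡a+r = %ℕ-unique (subst (y - + a ≡ₙ_) (cancel (+ a) (+ r)) (≡ₙ-+ʳ (- + a) y≡a+r))
      where
        cancel : ∀ a r → a + r - a ≡ r
        cancel = solve-∀

    a+0≡a : ∀ a → + a + + 0 ≡ + a
    a+0≡a a = +-identityʳ (+ a)

    a+1≡1+a : ∀ a → + a + + 1 ≡ + suc a
    a+1≡1+a a = cong +_ (ℕ.+-comm a 1)

    residue-at : ∀ {a y} → y ≡ₙ + a → (y - + a) %ℕ n ≡ 0
    residue-at {a} {y} y≡a = residue-of (subst (y ≡ₙ_) (sym (a+0≡a a)) y≡a) (s≤s z≤n)

    residue-at-suc : ∀ {a y} → y ≡ₙ + suc a → (y - + a) %ℕ n ≡ 1
    residue-at-suc {a} {y} y≡1+a = residue-of (subst (y ≡ₙ_) (sym (a+1≡1+a a)) y≡1+a) (s≤s (s≤s z≤n))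

  sref-at : ∀ {a y} → y ≡ₙ + a → sref n a y ≡ y + + 1
  sref-at {a} {y} y≡a = trans (sref-displace a y) (cong (λ d → displace d y) (residue-at y≡a))

  sref-at-suc : ∀ {a y} → y ≡ₙ + suc a → sref n a y ≡ y - + 1
  sref-at-suc {a} {y} y≡1+a = trans (sref-displace a y) (cong (λ d → displace d y) (residue-at-suc y≡1+a))

  data Position (a : ℕ) (y : ℤ) : Set where
    at-a   : y ≡ₙ + a     → sref n a y ≡ y + + 1 → Position a y
    at-a+1 : y ≡ₙ + suc a → sref n a y ≡ y - + 1 → Position a y
    away   : ¬ y ≡ₙ + a → ¬ y ≡ₙ + suc a → sref n a y ≡ y → Position a y

  position : ∀ a y → Position a y
  position a y with (y - + a) %ℕ n in res | ≡ₙ-residue y a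
  ... | 0           | y≡a+0 = let y≡a = subst (y ≡ₙ_) (a+0≡a a) y≡a+0 in at-a y≡a (sref-at y≡a)
  ... | 1           | y≡a+1 = let y≡1+a = subst (y ≡ₙ_) (a+1≡1+a a) y≡a+1 in at-a+1 y≡1+a (sref-at-suc y≡1+a)
  ... | suc (suc d) | _     = away (λ y≡a → 0≢2+ (trans (sym (residue-at y≡a)) res))
                                   (λ y≡1+a → 1≢2+ (trans (sym (residue-at-suc y≡1+a)) res))
                                   (trans (sref-displace a y) (cong (λ d → displace d y) res))
    where
      0≢2+ : 0 ≢ suc (suc d)
      0≢2+ ()
      1≢2+ : 1 ≢ suc (suc d)
      1≢2+ ()

  sref-away : ∀ {a y} → ¬ y ≡ₙ + a → ¬ y ≡ₙ + suc a → sref n a y ≡ y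
  sref-away {a} {y} y≢a y≢1+a with position a y
  ... | at-a   y≡a   _ = ⊥-elim (y≢a y≡a)
  ... | at-a+1 y≡1+a _ = ⊥-elim (y≢1+a y≡1+a)
  ... | away   _ _ fixed = fixed

  ≡ₙ-suc : ∀ {x a} → x ≡ₙ + a → x + + 1 ≡ₙ + suc a
  ≡ₙ-suc {x} {a} x≡a = subst (x + + 1 ≡ₙ_) (a+1≡1+a a) (≡ₙ-+ʳ (+ 1) x≡a)

  ≡ₙ-pred : ∀ {x a} → x ≡ₙ + suc a → x - + 1 ≡ₙ + a
  ≡ₙ-pred {x} {a} x≡1+a = subst (x - + 1 ≡ₙ_) (cancel (+ a)) (≡ₙ-+ʳ (- + 1) x≡1+a)
    where
      cancel : ∀ a → + 1 + a - + 1 ≡ a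
      cancel = solve-∀

  sref-self : ∀ a → sref n a (+ a) ≡ + suc a
  sref-self a = trans (sref-at ≡ₙ-refl) (a+1≡1+a a)

  sref-self-suc : ∀ a → sref n a (+ suc a) ≡ + a
  sref-self-suc a = trans (sref-at-suc ≡ₙ-refl) (cancel (+ a))
    where
      cancel : ∀ a → + 1 + a - + 1 ≡ a
      cancel = solve-∀

  sref-involutive : ∀ a y → sref n a (sref n a y) ≡ y
  sref-involutive a y with position a y
  ... | at-a y≡a moved = begin
    sref n a (sref n a y) ≡⟨ cong (sref n a) moved ⟩
    sref n a (y + + 1)    ≡⟨ sref-at-suc (≡ₙ-suc y≡a) ⟩
    y + + 1 - + 1         ≡⟨ cancel y (+ 1) ⟩
    y                     ∎
    where
      open ≡-Reasoning
      cancel : ∀ y c → y + c - c ≡ y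
      cancel = solve-∀
  ... | at-a+1 y≡1+a moved = begin
    sref n a (sref n a y) ≡⟨ cong (sref n a) moved ⟩
    sref n a (y - + 1)    ≡⟨ sref-at (≡ₙ-pred y≡1+a) ⟩
    y - + 1 + + 1         ≡⟨ cancel y (+ 1) ⟩
    y                     ∎
    where
      open ≡-Reasoning
      cancel : ∀ y c → y - c + c ≡ y
      cancel = solve-∀
  ... | away _ _ fixed = trans (cong (sref n a) fixed) fixed

  sref-injective : ∀ a → Injective _≡_ _≡_ (sref n a)
  sref-injective a {x} {y} sx≡sy = begin
    x                     ≡⟨ sref-involutive a x ⟨
    sref n a (sref n a x) ≡⟨ cong (sref n a) sx≡sy ⟩
    sref n a (sref n a y) ≡⟨ sref-involutive a y ⟩
    y                     ∎
    where open ≡-Reasoning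

  sref-≤-suc : ∀ a y → sref n a y ≤ y + + 1
  sref-≤-suc a y with position a y
  ... | at-a   _ moved   = ≤-reflexive moved
  ... | at-a+1 _ moved   = ≤-trans (≤-reflexive moved) (≤-trans (i-j≤i y (+ 1)) (i≤i+j y (+ 1)))
  ... | away   _ _ fixed = ≤-trans (≤-reflexive fixed) (i≤i+j y (+ 1))

  pred-≤-sref : ∀ a y → y - + 1 ≤ sref n a y
  pred-≤-sref a y with position a y
  ... | at-a   _ moved   = ≤-trans (≤-trans (i-j≤i y (+ 1)) (i≤i+j y (+ 1))) (≤-reflexive (sym moved))
  ... | at-a+1 _ moved   = ≤-reflexive (sym moved)
  ... | away   _ _ fixed = ≤-trans (i-j≤i y (+ 1)) (≤-reflexive (sym fixed))

  private
    <⇒≤-1 : ∀ {x y} → x < y → x ≤ y - + 1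
    <⇒≤-1 {x} {y} x<y = ≤-trans (i<j⇒i≤pred[j] x<y) (≤-reflexive (+-comm (- + 1) y))

    <⇒1+≤ : ∀ {x y} → x < y → x + + 1 ≤ y
    <⇒1+≤ {x} {y} x<y = ≤-trans (≤-reflexive (+-comm x (+ 1))) (i<j⇒suc[i]≤j x<y)

  sref-reverses : ∀ {a x y} → x < y → sref n a y < sref n a x → x ≡ₙ + a × y ≡ x + + 1
  sref-reverses {a} {x} {y} x<y sy<sx = x≡a , ≤-antisym y≤x+1 (<⇒1+≤ x<y)
    where
      x≤sy : x ≤ sref n a y
      x≤sy = ≤-trans (<⇒≤-1 x<y) (pred-≤-sref a y)
      y≤x+1 : y ≤ x + + 1
      y≤x+1 = ≤-trans (≤-reflexive (sym (cancel y (+ 1))))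
                (<⇒1+≤ (≤-<-trans (pred-≤-sref a y) (<-≤-trans sy<sx (sref-≤-suc a x))))
        where
          cancel : ∀ y c → y - c + c ≡ y
          cancel = solve-∀
      x≡a : x ≡ₙ + a
      x≡a with position a x
      ... | at-a   x≡a _     = x≡a
      ... | at-a+1 _ moved   = ⊥-elim (<-irrefl refl (<-≤-trans sy<sx (≤-trans (≤-reflexive moved) (≤-trans (i-j≤i x (+ 1)) x≤sy))))
      ... | away   _ _ fixed = ⊥-elim (<-irrefl refl (<-≤-trans sy<sx (≤-trans (≤-reflexive fixed) x≤sy)))

  module _ {g : ℤ → ℤ} (g-periodic : Periodic g) where

    periodic-≡ₙ : ∀ {x y} → x ≡ₙ y → g x ≡ₙ g y
    periodic-≡ₙ {y = y} (q , x≡y+qn) = q , trans (cong g x≡y+qn) (g-periodic q y)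

    periodic-≡ₙ⁻¹ : Injective _≡_ _≡_ g → ∀ {x y} → g x ≡ₙ g y → x ≡ₙ y
    periodic-≡ₙ⁻¹ g-injective {y = y} (q , gx≡gy+qn) = q , g-injective (trans gx≡gy+qn (sym (g-periodic q y)))

    periodic-suc : ∀ {j x} → g (+ suc j) ≡ g (+ j) + + 1 → x ≡ₙ + j → g (x + + 1) ≡ g x + + 1
    periodic-suc {j} {x} g1+j≡gj+1 (q , x≡j+qn) = begin
      g (x + + 1)               ≡⟨ cong (λ x → g (x + + 1)) x≡j+qn ⟩
      g (+ j + q * + n + + 1)   ≡⟨ cong g (rotate (+ j) (q * + n) (+ 1)) ⟩
      g (+ 1 + + j + q * + n)   ≡⟨ g-periodic q (+ suc j) ⟩
      g (+ suc j) + q * + n     ≡⟨ cong (_+ q * + n) g1+j≡gj+1 ⟩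
      g (+ j) + + 1 + q * + n   ≡⟨ swap (g (+ j)) (+ 1) (q * + n) ⟩
      g (+ j) + q * + n + + 1   ≡⟨ cong (_+ + 1) (g-periodic q (+ j)) ⟨
      g (+ j + q * + n) + + 1   ≡⟨ cong (λ x → g x + + 1) x≡j+qn ⟨
      g x + + 1                 ∎
      where
        open ≡-Reasoning
        rotate : ∀ a b c → a + b + c ≡ c + a + b
        rotate = solve-∀
        swap : ∀ a b c → a + b + c ≡ a + c + b
        swap = solve-∀

    sref-conjugate : Injective _≡_ _≡_ g → ∀ {a j} → g (+ j) ≡ₙ + a → g (+ suc j) ≡ g (+ j) + + 1 →
                     ∀ x → sref n a (g x) ≡ g (sref n j x)
    sref-conjugate g-injective {a} {j} gj≡a g1+j≡gj+1 x = conjugate (position j x)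
      where
        open ≡-Reasoning
        g1+j≡1+a : g (+ suc j) ≡ₙ + suc a
        g1+j≡1+a = subst (_≡ₙ + suc a) (sym g1+j≡gj+1) (≡ₙ-suc gj≡a)
        conjugate : Position j x → sref n a (g x) ≡ g (sref n j x)
        conjugate (at-a x≡j moved) = begin
          sref n a (g x) ≡⟨ sref-at (≡ₙ-trans (periodic-≡ₙ x≡j) gj≡a) ⟩
          g x + + 1      ≡⟨ periodic-suc g1+j≡gj+1 x≡j ⟨
          g (x + + 1)    ≡⟨ cong g moved ⟨
          g (sref n j x) ∎
        conjugate (at-a+1 x≡1+j moved) = begin
          sref n a (g x)          ≡⟨ sref-at-suc (≡ₙ-trans (periodic-≡ₙ x≡1+j) g1+j≡1+a) ⟩
          g x - + 1               ≡⟨ cong (λ x → g x - + 1) (cancelˡ x (+ 1)) ⟨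
          g (x - + 1 + + 1) - + 1 ≡⟨ cong (_- + 1) (periodic-suc g1+j≡gj+1 (≡ₙ-pred x≡1+j)) ⟩
          g (x - + 1) + + 1 - + 1 ≡⟨ cancelʳ (g (x - + 1)) (+ 1) ⟩
          g (x - + 1)             ≡⟨ cong g moved ⟨
          g (sref n j x)          ∎
          where
            cancelˡ : ∀ x c → x - c + c ≡ x
            cancelˡ = solve-∀
            cancelʳ : ∀ x c → x + c - c ≡ x
            cancelʳ = solve-∀
        conjugate (away x≢j x≢1+j fixed) = begin
          sref n a (g x) ≡⟨ sref-away (λ gx≡a → x≢j (periodic-≡ₙ⁻¹ g-injective (≡ₙ-trans gx≡a (≡ₙ-sym gj≡a))))
                                     (λ gx≡1+a → x≢1+j (periodic-≡ₙ⁻¹ g-injective (≡ₙ-trans gx≡1+a (≡ₙ-sym g1+j≡1+a)))) ⟩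
          g x            ≡⟨ cong g fixed ⟨
          g (sref n j x) ∎

  periodic-∘ : ∀ {f g} → Periodic f → Periodic g → Periodic (f ∘ g)
  periodic-∘ {f} {g} f-periodic g-periodic q y = trans (cong f (g-periodic q y)) (f-periodic q (g y))

  wordProd-periodic : ∀ ws → Periodic (wordProd n ws)
  wordProd-periodic []       q y = refl
  wordProd-periodic (a ∷ ws) = periodic-∘ {sref n a} {wordProd n ws} (sref-periodic a) (wordProd-periodic ws)

  wordProd-injective : ∀ ws → Injective _≡_ _≡_ (wordProd n ws)
  wordProd-injective []       eq = eq
  wordProd-injective (a ∷ ws) eq = wordProd-injective ws (sref-injective a eq)

  exchange : ∀ ws j → wordProd n ws (+ suc j) < wordProd n ws (+ j) →
             Σ[ ws′ ∈ List ℕ ] length ws′ ℕ.< length ws × wordProd n ws′ ≈ₐ (wordProd n ws ∘ sref n j)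
  exchange []       j desc = ⊥-elim (<-asym desc (+<+ (ℕ.n<1+n j)))
  exchange (a ∷ ws) j desc with <-cmp (wordProd n ws (+ j)) (wordProd n ws (+ suc j))
  ... | tri> _ _ desc′ with exchange ws j desc′
  ...   | ws′ , shorter , ws′≈ = a ∷ ws′ , s≤s shorter , λ x → cong (sref n a) (ws′≈ x)
  exchange (a ∷ ws) j desc | tri≈ _ same _ = ⊥-elim (ℕ.1+n≢n (+-injective (sym (wordProd-injective ws same))))
  exchange (a ∷ ws) j desc | tri< asc _ _ = ws , ℕ.n<1+n (length ws) , cancelled
    where
      w : ℤ → ℤ
      w = wordProd n ws
      reversed : w (+ j) ≡ₙ + a × w (+ suc j) ≡ w (+ j) + + 1
      reversed = sref-reverses asc desc
      conjugate : ∀ x → sref n a (w x) ≡ w (sref n j x)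
      conjugate = sref-conjugate (wordProd-periodic ws) (wordProd-injective ws) (proj₁ reversed) (proj₂ reversed)
      cancelled : w ≈ₐ (sref n a ∘ w ∘ sref n j)
      cancelled x = sym (begin
        sref n a (w (sref n j x)) ≡⟨ conjugate (sref n j x) ⟩
        w (sref n j (sref n j x)) ≡⟨ cong w (sref-involutive j x) ⟩
        w x                       ∎)
        where open ≡-Reasoning

  ascent⇒¬shorter : ∀ w j → w (+ j) < w (+ suc j) → ¬ ((w ∘ sref n j) <ℓ[ n ] w)
  ascent⇒¬shorter w j asc (a , b , ((ws , |ws|≡a , ws≈) , _) , (_ , minimal) , a<b) = impossible (exchange ws j desc)
    where
      desc : wordProd n ws (+ suc j) < wordProd n ws (+ j)
      desc = subst₂ _<_ (sym (trans (ws≈ (+ suc j)) (cong w (sref-self-suc j))))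
                        (sym (trans (ws≈ (+ j)) (cong w (sref-self j)))) asc
      impossible : ¬ (Σ[ ws′ ∈ List ℕ ] length ws′ ℕ.< length ws × wordProd n ws′ ≈ₐ (wordProd n ws ∘ sref n j))
      impossible (ws′ , shorter , ws′≈) = ℕ.<-irrefl refl (begin-strict
        b             ≤⟨ minimal ws′ ws′≈w ⟩
        length ws′    <⟨ shorter ⟩
        length ws     ≡⟨ |ws|≡a ⟩
        a             <⟨ a<b ⟩
        b             ∎)
        where
          open ℕ.≤-Reasoning
          ws′≈w : wordProd n ws′ ≈ₐ w
          ws′≈w x = trans (ws′≈ x) (trans (ws≈ (sref n j x)) (cong w (sref-involutive j x)))

module Grid (k : ℕ) where
  open import Data.Nat as ℕ using (ℕ; zero; suc; z≤n; s≤s; z<s)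
  import Data.Nat.Properties as ℕ
  open import Data.Nat.DivMod
    using (_/_; _%_; m≡m%n+[m/n]*n; m%n<n; m<n*o⇒m/o<n; +-distrib-/-∣ˡ; m<n⇒m/n≡0; m*n/n≡m; /-monoˡ-≤)
  open import Data.Nat.Divisibility using (n∣m*n)
  open import Data.Nat.Induction using (<-rec)
  open import Data.Nat.Tactic.RingSolver as ℕ-Solver using ()
  open import Data.Integer using (ℤ; +_; _+_; _-_; _*_; -_; _<_; _≤_; +<+)
  open import Data.Integer.Properties
  open import Data.Integer.Tactic.RingSolver using (solve-∀)
  open import Data.Bool using (Bool; true; false)
  open import Data.Sum using (inj₁; inj₂)
  open import Data.Empty using (⊥-elim)
  open import Relation.Nullary using (¬_)
  open import Relation.Binary.PropositionalEquality
  open import Algebra.Properties.AbelianGroup +-0-abelianGroup using (∙-cancelˡ)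
  open Counting

  private
    +-cancelʳ-< : ∀ {x y} z → x + z < y + z → x < y
    +-cancelʳ-< {x} {y} z x+z<y+z = subst₂ _<_ (cancel x z) (cancel y z) (+-monoˡ-< (- z) x+z<y+z)
      where
        cancel : ∀ x z → x + z + - z ≡ x
        cancel = solve-∀

  n m N : ℕ
  n = suc (suc k)
  m = suc k
  N = n ℕ.* m

  private
    x+n≢x : ∀ x → x + + n ≢ x
    x+n≢x x x+n≡x with ∙-cancelˡ x (+ n) (+ 0) (trans x+n≡x (sym (+-identityʳ x)))
    ... | ()

  cell : ℕ → ℕ → ℕ
  cell r c = r ℕ.* m ℕ.+ c

  threshold : ℕ → ℤ
  threshold t = + (t ℕ.+ suc (t / m))

  cell-suc : ∀ r c → cell (suc r) c ≡ cell r c ℕ.+ m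
  cell-suc r c = shift r c m
    where
      shift : ∀ r c m → m ℕ.+ r ℕ.* m ℕ.+ c ≡ r ℕ.* m ℕ.+ c ℕ.+ m
      shift = ℕ-Solver.solve-∀

  data Cell : ℕ → Set where
    cell-at : ∀ {r c} → r ℕ.< n → c ℕ.< m → Cell (cell r c)

  cell-view : ∀ {t} → t ℕ.< N → Cell t
  cell-view {t} t<N = subst Cell (sym (trans (m≡m%n+[m/n]*n t m) (ℕ.+-comm (t % m) _)))
                            (cell-at (m<n*o⇒m/o<n t<N) (m%n<n t m))

  cell-<-row : ∀ {r r′} c → r ℕ.< r′ → cell r c ℕ.< cell r′ c
  cell-<-row c r<r′ = ℕ.+-monoˡ-< c (ℕ.*-monoˡ-< m r<r′)

  cell<N : ∀ {r c} → r ℕ.< n → c ℕ.< m → cell r c ℕ.< N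
  cell<N {r} {c} r<n c<m = begin-strict
    r ℕ.* m ℕ.+ c   <⟨ ℕ.+-monoʳ-< (r ℕ.* m) c<m ⟩
    r ℕ.* m ℕ.+ m   ≡⟨ ℕ.+-comm (r ℕ.* m) m ⟩
    suc r ℕ.* m     ≤⟨ ℕ.*-monoˡ-≤ m r<n ⟩
    N               ∎
    where open ℕ.≤-Reasoning

  cell/m : ∀ r {c} → c ℕ.< m → cell r c / m ≡ r
  cell/m r {c} c<m = begin
    (r ℕ.* m ℕ.+ c) / m     ≡⟨ +-distrib-/-∣ˡ c (n∣m*n r) ⟩
    r ℕ.* m / m ℕ.+ c / m   ≡⟨ cong₂ ℕ._+_ (m*n/n≡m r m) (m<n⇒m/n≡0 c<m) ⟩
    r ℕ.+ 0                 ≡⟨ ℕ.+-identityʳ r ⟩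
    r                       ∎
    where open ≡-Reasoning

  threshold-cell : ∀ r {c} → c ℕ.< m → threshold (cell r c) ≡ + r * + n + + suc c
  threshold-cell r {c} c<m = begin
    + (cell r c ℕ.+ suc (cell r c / m)) ≡⟨ cong (λ q → + (cell r c ℕ.+ suc q)) (cell/m r c<m) ⟩
    + (r ℕ.* m ℕ.+ c ℕ.+ suc r)         ≡⟨ cong +_ (regroup r c k) ⟩
    + (r ℕ.* n ℕ.+ suc c)               ≡⟨ cong (_+ + suc c) (pos-* r n) ⟩
    + r * + n + + suc c                 ∎
    where
      open ≡-Reasoning
      regroup : ∀ r c k → r ℕ.* suc k ℕ.+ c ℕ.+ suc r ≡ r ℕ.* suc (suc k) ℕ.+ suc c
      regroup = ℕ-Solver.solve-∀

  threshold-rows : ∀ r r′ {c} → c ℕ.< m → threshold (cell r′ c) ≡ threshold (cell r c) + (+ r′ - + r) * + n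
  threshold-rows r r′ {c} c<m = begin
    threshold (cell r′ c)                        ≡⟨ threshold-cell r′ c<m ⟩
    + r′ * + n + + suc c                         ≡⟨ shift (+ r) (+ r′) (+ n) (+ suc c) ⟩
    + r * + n + + suc c + (+ r′ - + r) * + n     ≡⟨ cong (_+ (+ r′ - + r) * + n) (threshold-cell r c<m) ⟨
    threshold (cell r c) + (+ r′ - + r) * + n    ∎
    where
      open ≡-Reasoning
      shift : ∀ r r′ n c → r′ * n + c ≡ r * n + c + (r′ - r) * n
      shift = solve-∀

  threshold-< : ∀ t → threshold t < threshold (suc t)
  threshold-< t = +<+ (s≤s (ℕ.+-monoʳ-≤ t (s≤s (/-monoˡ-≤ m (ℕ.n≤1+n t)))))

  threshold<N+n : ∀ {t} → t ℕ.< N → threshold t < + N + + n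
  threshold<N+n t<N = +<+ (ℕ.+-mono-<-≤ t<N (m<n*o⇒m/o<n t<N))

  -- What the counting argument needs to know about horiz t = u₍ₜ₎(t) and vert t = u₍ₜ₎(t + 1).
  record Wiring : Set where
    field
      kept          : ℕ → Bool
      horiz vert    : ℕ → ℤ
      horiz-zero    : horiz 0 ≡ + 0
      horiz-end     : horiz N ≡ + N
      horiz-kept    : ∀ t → kept t ≡ true  → horiz (suc t) ≡ horiz t
      horiz-skipped : ∀ t → kept t ≡ false → horiz (suc t) ≡ vert t
      vert-kept     : ∀ t → kept t ≡ true  → vert (t ℕ.+ m) ≡ vert t + + n
      vert-skipped  : ∀ t → kept t ≡ false → vert (t ℕ.+ m) ≡ horiz t + + n
      vert-top      : ∀ c → c ℕ.< m → vert c ≡ + suc c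
      vert-bottom   : ∀ c → vert (N ℕ.+ c) ≡ + suc (N ℕ.+ c)
      vert≢horiz+n  : ∀ t → vert t ≢ horiz t + + n
      skip-count    : #false kept N ≡ m ℕ.* 2

  module _ (W : Wiring) where
    open Wiring W

    column : ℕ → ℕ → Bool
    column c r = kept (cell r c)

    vert-run : ∀ {a b} c → a ℕ.≤ b → AllTrue (column c) a b →
               vert (cell b c) ≡ vert (cell a c) + (+ b - + a) * + n
    vert-run {a} {b} c a≤b kept-a-b with ℕ.m≤n⇒m<n∨m≡n a≤b
    ... | inj₂ refl = no-change (vert (cell a c)) (+ a) (+ n)
      where
        no-change : ∀ v a n → v ≡ v + (a - a) * n
        no-change = solve-∀
    vert-run {a} {suc b} c a≤1+b kept-a-b | inj₁ a<1+b = begin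
      vert (cell (suc b) c)                             ≡⟨ cong vert (cell-suc b c) ⟩
      vert (cell b c ℕ.+ m)                             ≡⟨ vert-kept (cell b c) (kept-a-b b (ℕ.s≤s⁻¹ a<1+b) ℕ.≤-refl) ⟩
      vert (cell b c) + + n                             ≡⟨ cong (_+ + n) (vert-run c (ℕ.s≤s⁻¹ a<1+b) kept-a-b′) ⟩
      vert (cell a c) + (+ b - + a) * + n + + n         ≡⟨ regroup (vert (cell a c)) (+ a) (+ b) (+ n) ⟩
      vert (cell a c) + (+ suc b - + a) * + n           ∎
      where
        open ≡-Reasoning
        kept-a-b′ : AllTrue (column c) a b
        kept-a-b′ i a≤i i<b = kept-a-b i a≤i (ℕ.m<n⇒m<1+n i<b)
        regroup : ∀ v a b n → v + (b - a) * n + n ≡ v + (+ 1 + b - a) * n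
        regroup = solve-∀

    vert-below-skip : ∀ r c → column c r ≡ false → vert (cell (suc r) c) ≡ horiz (cell r c) + + n
    vert-below-skip r c skip = trans (cong vert (cell-suc r c)) (vert-skipped (cell r c) skip)

    vert-after-skip : ∀ {r₁ r₂} c → r₁ ℕ.< r₂ → column c r₁ ≡ false → AllTrue (column c) (suc r₁) r₂ →
                      vert (cell r₂ c) ≡ horiz (cell r₁ c) + (+ r₂ - + r₁) * + n
    vert-after-skip {r₁} {r₂} c r₁<r₂ skip kept-between = begin
      vert (cell r₂ c)                                          ≡⟨ vert-run c r₁<r₂ kept-between ⟩
      vert (cell (suc r₁) c) + (+ r₂ - + suc r₁) * + n          ≡⟨ cong (_+ (+ r₂ - + suc r₁) * + n) (vert-below-skip r₁ c skip) ⟩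
      horiz (cell r₁ c) + + n + (+ r₂ - (+ 1 + + r₁)) * + n     ≡⟨ regroup (horiz (cell r₁ c)) (+ r₁) (+ r₂) (+ n) ⟩
      horiz (cell r₁ c) + (+ r₂ - + r₁) * + n                   ∎
      where
        open ≡-Reasoning
        regroup : ∀ h r₁ r₂ n → h + n + (r₂ - (+ 1 + r₁)) * n ≡ h + (r₂ - r₁) * n
        regroup = solve-∀

    vert-from-top : ∀ {r c} → c ℕ.< m → AllTrue (column c) 0 r → vert (cell r c) ≡ threshold (cell r c)
    vert-from-top {r} {c} c<m kept-above = begin
      vert (cell r c)                 ≡⟨ vert-run c z≤n kept-above ⟩
      vert c + (+ r - + 0) * + n      ≡⟨ cong (_+ (+ r - + 0) * + n) (vert-top c c<m) ⟩
      + suc c + (+ r - + 0) * + n     ≡⟨ regroup (+ r) (+ n) (+ suc c) ⟩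
      + r * + n + + suc c             ≡⟨ threshold-cell r c<m ⟨
      threshold (cell r c)            ∎
      where
        open ≡-Reasoning
        regroup : ∀ r n c → c + (r - + 0) * n ≡ r * n + c
        regroup = solve-∀

    vert-from-bottom : ∀ {r c} → c ℕ.< m → r ℕ.≤ n → AllTrue (column c) r n →
                       vert (cell r c) + + n ≡ threshold (cell r c)
    vert-from-bottom {r} {c} c<m r≤n kept-below = begin
      vert (cell r c) + + n                             ≡⟨ unshift (vert (cell r c)) rise (+ n) ⟩
      vert (cell r c) + rise - rise + + n               ≡⟨ cong (λ v → v - rise + + n) (vert-run c r≤n kept-below) ⟨
      vert (N ℕ.+ c) - rise + + n                       ≡⟨ cong (λ v → v - rise + + n) (vert-bottom c) ⟩
      + 1 + (+ N + + c) - rise + + n                    ≡⟨ cong (λ v → + 1 + (v + + c) - rise + + n) (pos-* n m) ⟩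
      + 1 + (+ n * + m + + c) - rise + + n              ≡⟨ regroup (+ r) (+ m) (+ c) ⟩
      + r * + n + + suc c                               ≡⟨ threshold-cell r c<m ⟨
      threshold (cell r c)                              ∎
      where
        open ≡-Reasoning
        rise : ℤ
        rise = (+ n - + r) * + n
        unshift : ∀ v d n → v + n ≡ v + d - d + n
        unshift = solve-∀
        regroup : ∀ r m c → + 1 + ((+ 1 + m) * m + c) - ((+ 1 + m) - r) * (+ 1 + m) + (+ 1 + m) ≡ r * (+ 1 + m) + (+ 1 + c)
        regroup = solve-∀

    horiz-at-last-skip : ∀ {r c} → c ℕ.< m → r ℕ.< n → column c r ≡ false → AllTrue (column c) (suc r) n →
                         horiz (cell r c) + + n ≡ threshold (cell r c)
    horiz-at-last-skip {r} {c} c<m r<n skip kept-below = begin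
      horiz (cell r c) + + n                                  ≡⟨ vert-below-skip r c skip ⟨
      vert (cell (suc r) c)                                   ≡⟨ cancel (vert (cell (suc r) c)) (+ n) ⟨
      vert (cell (suc r) c) + + n - + n                       ≡⟨ cong (_- + n) (vert-from-bottom c<m r<n kept-below) ⟩
      threshold (cell (suc r) c) - + n                        ≡⟨ cong (_- + n) (threshold-rows r (suc r) c<m) ⟩
      threshold (cell r c) + (+ 1 + + r - + r) * + n - + n    ≡⟨ regroup (threshold (cell r c)) (+ r) (+ n) ⟩
      threshold (cell r c)                                    ∎
      where
        open ≡-Reasoning
        cancel : ∀ v n → v + n - n ≡ v
        cancel = solve-∀
        regroup : ∀ t r n → t + (+ 1 + r - r) * n - n ≡ t
        regroup = solve-∀

    column-skips≥2 : ∀ {c} → c ℕ.< m → 2 ℕ.≤ #false (column c) n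
    column-skips≥2 {c} c<m = 2≤#false (column c) not-all-kept no-single-skip
      where
        not-all-kept : ¬ AllTrue (column c) 0 n
        not-all-kept kept-all = x+n≢x (vert (cell n c))
          (trans (vert-from-bottom c<m ℕ.≤-refl (λ i n≤i i<n → ⊥-elim (ℕ.<⇒≱ i<n n≤i))) (sym (vert-from-top c<m kept-all)))
        no-single-skip : ∀ r → r ℕ.< n → column c r ≡ false → AllTrue (column c) 0 r → ¬ AllTrue (column c) (suc r) n
        no-single-skip r r<n skip kept-above kept-below =
          vert≢horiz+n (cell r c) (trans (vert-from-top c<m kept-above) (sym (horiz-at-last-skip c<m r<n skip kept-below)))

    column-skips≡2 : ∀ {c} → c ℕ.< m → #false (column c) n ≡ 2
    column-skips≡2 {c} c<m = sumTo-tight m 2 (λ c → #false (column c) n) (λ _ → column-skips≥2)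
                               (trans (sym (sumTo-rows m n _)) skip-count) c c<m

    skip-role : ∀ {r c} → r ℕ.< n → c ℕ.< m → column c r ≡ false → FalseRole (column c) n r
    skip-role r<n c<m skip = false-role _ (column-skips≡2 c<m) r<n skip

    horiz-suc≤threshold : ∀ {s} → Cell s → (∀ {t} → t ℕ.≤ s → horiz t < threshold t) → horiz (suc s) ≤ threshold s
    horiz-suc≤threshold (cell-at {r} {c} r<n c<m) earlier = by-letter (kept (cell r c)) refl
      where
        by-role : column c r ≡ false → FalseRole (column c) n r → horiz (suc (cell r c)) ≤ threshold (cell r c)
        by-role skip (first kept-above _ _ _ _ _) = ≤-reflexive (trans (horiz-skipped _ skip) (vert-from-top c<m kept-above))
        by-role skip (second _ r₁ r₁<r skip₁ kept-between) = <⇒≤ (begin-strict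
          horiz (suc (cell r c))                       ≡⟨ horiz-skipped _ skip ⟩
          vert (cell r c)                              ≡⟨ vert-after-skip c r₁<r skip₁ kept-between ⟩
          horiz (cell r₁ c) + (+ r - + r₁) * + n       <⟨ +-monoˡ-< ((+ r - + r₁) * + n) (earlier (ℕ.<⇒≤ (cell-<-row c r₁<r))) ⟩
          threshold (cell r₁ c) + (+ r - + r₁) * + n   ≡⟨ threshold-rows r₁ r c<m ⟨
          threshold (cell r c)                         ∎)
          where open ≤-Reasoning
        by-letter : ∀ b → column c r ≡ b → horiz (suc (cell r c)) ≤ threshold (cell r c)
        by-letter true  kept = ≤-trans (≤-reflexive (horiz-kept _ kept)) (<⇒≤ (earlier ℕ.≤-refl))
        by-letter false skip = by-role skip (skip-role r<n c<m skip)

    horiz<threshold : ∀ t → t ℕ.≤ N → horiz t < threshold t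
    horiz<threshold = <-rec (λ t → t ℕ.≤ N → horiz t < threshold t) step
      where
        step : ∀ t → (∀ {t′} → t′ ℕ.< t → t′ ℕ.≤ N → horiz t′ < threshold t′) → t ℕ.≤ N → horiz t < threshold t
        step zero    _       _     = subst (_< threshold 0) (sym horiz-zero) (+<+ z<s)
        step (suc s) earlier 1+s≤N = ≤-<-trans
          (horiz-suc≤threshold (cell-view 1+s≤N) (λ t≤s → earlier (s≤s t≤s) (ℕ.≤-trans t≤s (ℕ.<⇒≤ 1+s≤N))))
          (threshold-< s)

    threshold≤horiz+n : ∀ {s} → Cell s → (∀ {t} → s ℕ.≤ t → t ℕ.< N → threshold t < horiz (suc t) + + n) →
                        threshold s ≤ horiz s + + n
    threshold≤horiz+n (cell-at {r} {c} r<n c<m) later = by-letter (kept (cell r c)) refl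
      where
        by-role : column c r ≡ false → FalseRole (column c) n r → threshold (cell r c) ≤ horiz (cell r c) + + n
        by-role skip (second kept-below _ _ _ _) = ≤-reflexive (sym (horiz-at-last-skip c<m r<n skip kept-below))
        by-role skip (first _ r₂ r<r₂ r₂<n skip₂ kept-between) = <⇒≤ (+-cancelʳ-< ((+ r₂ - + r) * + n) (begin-strict
          threshold (cell r c) + (+ r₂ - + r) * + n      ≡⟨ threshold-rows r r₂ c<m ⟨
          threshold (cell r₂ c)                          <⟨ later (ℕ.<⇒≤ (cell-<-row c r<r₂)) (cell<N r₂<n c<m) ⟩
          horiz (suc (cell r₂ c)) + + n                  ≡⟨ cong (_+ + n) (horiz-skipped _ skip₂) ⟩
          vert (cell r₂ c) + + n                         ≡⟨ cong (_+ + n) (vert-after-skip c r<r₂ skip kept-between) ⟩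
          horiz (cell r c) + (+ r₂ - + r) * + n + + n    ≡⟨ swap (horiz (cell r c)) ((+ r₂ - + r) * + n) (+ n) ⟩
          horiz (cell r c) + + n + (+ r₂ - + r) * + n    ∎))
          where
            open ≤-Reasoning
            swap : ∀ a b c → a + b + c ≡ a + c + b
            swap = solve-∀
        by-letter : ∀ b → column c r ≡ b → threshold (cell r c) ≤ horiz (cell r c) + + n
        by-letter true  kept = <⇒≤ (subst (λ h → threshold (cell r c) < h + + n) (horiz-kept _ kept) (later ℕ.≤-refl (cell<N r<n c<m)))
        by-letter false skip = by-role skip (skip-role r<n c<m skip)

    threshold<horiz-suc+n : ∀ t → t ℕ.< N → threshold t < horiz (suc t) + + n
    threshold<horiz-suc+n = downward-rec (λ t → threshold t < horiz (suc t) + + n) step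
      where
        step : ∀ t → t ℕ.< N → (∀ t′ → t ℕ.< t′ → t′ ℕ.< N → threshold t′ < horiz (suc t′) + + n) →
               threshold t < horiz (suc t) + + n
        step t t<N later with ℕ.m≤n⇒m<n∨m≡n t<N
        ... | inj₂ 1+t≡N = subst (λ h → threshold t < h + + n) (sym (trans (cong horiz 1+t≡N) horiz-end)) (threshold<N+n t<N)
        ... | inj₁ 1+t<N = <-≤-trans (threshold-< t) (threshold≤horiz+n (cell-view 1+t<N) (λ {t′} → later t′))

    skipped⇒ascent : ∀ {t} → t ℕ.< N → kept t ≡ false → horiz t < vert t
    skipped⇒ascent t<N = ascent (cell-view t<N)
      where
        ascent : ∀ {t} → Cell t → kept t ≡ false → horiz t < vert t
        ascent (cell-at {r} {c} r<n c<m) skip = by-role (skip-role r<n c<m skip)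
          where
            by-role : FalseRole (column c) n r → horiz (cell r c) < vert (cell r c)
            by-role (first kept-above _ _ _ _ _) = begin-strict
              horiz (cell r c)       <⟨ horiz<threshold (cell r c) (ℕ.<⇒≤ (cell<N r<n c<m)) ⟩
              threshold (cell r c)   ≡⟨ vert-from-top c<m kept-above ⟨
              vert (cell r c)        ∎
              where open ≤-Reasoning
            by-role (second kept-below _ _ _ _) = +-cancelʳ-< (+ n) (begin-strict
              horiz (cell r c) + + n         ≡⟨ horiz-at-last-skip c<m r<n skip kept-below ⟩
              threshold (cell r c)           <⟨ threshold<horiz-suc+n (cell r c) (cell<N r<n c<m) ⟩
              horiz (suc (cell r c)) + + n   ≡⟨ cong (_+ + n) (horiz-skipped (cell r c) skip) ⟩
              vert (cell r c) + + n          ∎)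
              where open ≤-Reasoning

-- Positions past the end of the list count as skips, where the letter is the identity.
kept : List Bool → ℕ → Bool
kept []       _       = false
kept (b ∷ bs) zero    = b
kept (b ∷ bs) (suc t) = kept bs t

module Prefixes (k : ℕ) where
  open import Data.Nat as ℕ using (ℕ; zero; suc; s≤s; z<s)
  import Data.Nat.Properties as ℕ
  open import Data.Integer using (ℤ; +_; _+_; _*_)
  open import Data.Integer.Properties using (*-identityˡ; +-injective)
  open import Data.Bool using (Bool; true; false)
  open import Data.List using (List; []; _∷_; length; take)
  open import Data.Vec using (Vec; toList)
  open import Data.Vec.Properties using (length-toList)
  open import Data.Product using (_,_)
  open import Function using (id)
  open import Function.Definitions using (Injective)
  open import Relation.Nullary using (¬_)
  open import Relation.Binary.PropositionalEquality
  open Counting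
  open Reflections k
  open Grid k using (m; N; Wiring)

  letter : ℕ → Bool → ℤ → ℤ
  letter p true  = sref n p
  letter p false = id

  letter-away : ∀ {p x} b → ¬ x ≡ₙ + p → ¬ x ≡ₙ + suc p → letter p b x ≡ x
  letter-away true  x≢p x≢1+p = sref-away x≢p x≢1+p
  letter-away false _   _     = refl

  subProd-take-suc : ∀ p t bs x → subProd n p (take (suc t) bs) x ≡ subProd n p (take t bs) (letter (p ℕ.+ t) (kept bs t) x)
  subProd-take-suc p zero    []           x = refl
  subProd-take-suc p (suc t) []           x = refl
  subProd-take-suc p zero    (true ∷ bs)  x = cong (λ q → sref n q x) (sym (ℕ.+-identityʳ p))
  subProd-take-suc p zero    (false ∷ bs) x = refl
  subProd-take-suc p (suc t) (true ∷ bs)  x = cong (sref n p) (trans (subProd-take-suc (suc p) t bs x)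
    (cong (λ q → subProd n (suc p) (take t bs) (letter q (kept bs t) x)) (sym (ℕ.+-suc p t))))
  subProd-take-suc p (suc t) (false ∷ bs) x = trans (subProd-take-suc (suc p) t bs x)
    (cong (λ q → subProd n (suc p) (take t bs) (letter q (kept bs t) x)) (sym (ℕ.+-suc p t)))

  subProd-periodic : ∀ p bs → Periodic (subProd n p bs)
  subProd-periodic p []           q y = refl
  subProd-periodic p (true ∷ bs)  = periodic-∘ {sref n p} {subProd n (suc p) bs} (sref-periodic p) (subProd-periodic (suc p) bs)
  subProd-periodic p (false ∷ bs) = subProd-periodic (suc p) bs

  subProd-injective : ∀ p bs → Injective _≡_ _≡_ (subProd n p bs)
  subProd-injective p []           eq = eq
  subProd-injective p (true ∷ bs)  eq = subProd-injective (suc p) bs (sref-injective p eq)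
  subProd-injective p (false ∷ bs) eq = subProd-injective (suc p) bs eq

  kept-beyond : ∀ bs {t} → length bs ℕ.≤ t → kept bs t ≡ false
  kept-beyond []       _       = refl
  kept-beyond (b ∷ bs) (s≤s l) = kept-beyond bs l

  skips≡#false : ∀ bs → skips bs ≡ #false (kept bs) (length bs)
  skips≡#false []           = refl
  skips≡#false (true ∷ bs)  = trans (skips≡#false bs) (sym (#false-shift (kept (true ∷ bs)) (length bs)))
  skips≡#false (false ∷ bs) = trans (cong suc (skips≡#false bs)) (sym (#false-shift (kept (false ∷ bs)) (length bs)))

  module _ (xs : List Bool) where

    prefix : ℕ → ℤ → ℤ
    prefix t = subProd n 0 (take t xs)

    prefix-suc : ∀ t x → prefix (suc t) x ≡ prefix t (letter t (kept xs t) x)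
    prefix-suc t = subProd-take-suc 0 t xs

    prefix-fixes : ∀ t d {x} → (∀ i → i ℕ.< d → letter (t ℕ.+ i) (kept xs (t ℕ.+ i)) x ≡ x) → prefix (t ℕ.+ d) x ≡ prefix t x
    prefix-fixes t zero    {x} _     = cong (λ s → prefix s x) (ℕ.+-identityʳ t)
    prefix-fixes t (suc d) {x} fixes = begin
      prefix (t ℕ.+ suc d) x                                   ≡⟨ cong (λ s → prefix s x) (ℕ.+-suc t d) ⟩
      prefix (suc (t ℕ.+ d)) x                                 ≡⟨ prefix-suc (t ℕ.+ d) x ⟩
      prefix (t ℕ.+ d) (letter (t ℕ.+ d) (kept xs (t ℕ.+ d)) x) ≡⟨ cong (prefix (t ℕ.+ d)) (fixes d ℕ.≤-refl) ⟩
      prefix (t ℕ.+ d) x                                       ≡⟨ prefix-fixes t d (λ i i<d → fixes i (ℕ.m<n⇒m<1+n i<d)) ⟩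
      prefix t x                                               ∎
      where open ≡-Reasoning

    horiz vert : ℕ → ℤ
    horiz t = prefix t (+ t)
    vert  t = prefix t (+ suc t)

    prefix-periodic : ∀ t → Periodic (prefix t)
    prefix-periodic t = subProd-periodic 0 (take t xs)

    prefix-injective : ∀ t → Injective _≡_ _≡_ (prefix t)
    prefix-injective t = subProd-injective 0 (take t xs)

    prefix-suc-at : ∀ {t b} x → kept xs t ≡ b → prefix (suc t) x ≡ prefix t (letter t b x)
    prefix-suc-at {t} x kt≡b = trans (prefix-suc t x) (cong (λ b → prefix t (letter t b x)) kt≡b)

    prefix-+n : ∀ t x → prefix t (x + + n) ≡ prefix t x + + n
    prefix-+n t x = begin
      prefix t (x + + n)           ≡⟨ cong (λ y → prefix t (x + y)) (*-identityˡ (+ n)) ⟨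
      prefix t (x + + 1 * + n)     ≡⟨ prefix-periodic t (+ 1) x ⟩
      prefix t x + + 1 * + n       ≡⟨ cong (λ y → prefix t x + y) (*-identityˡ (+ n)) ⟩
      prefix t x + + n             ∎
      where open ≡-Reasoning

    vert-below : ∀ t → vert (t ℕ.+ m) ≡ prefix (suc t) (+ t) + + n
    vert-below t = begin
      prefix (t ℕ.+ m) (+ suc (t ℕ.+ m))       ≡⟨ cong₂ prefix (ℕ.+-suc t k) (cong +_ (sym (ℕ.+-suc t m))) ⟩
      prefix (suc t ℕ.+ k) (+ t + + n)          ≡⟨ prefix-fixes (suc t) k (λ i i<k → letter-away (kept xs (suc t ℕ.+ i)) (≢ₙ-first i i<k) (≢ₙ-second i i<k)) ⟩
      prefix (suc t) (+ t + + n)                ≡⟨ prefix-+n (suc t) (+ t) ⟩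
      prefix (suc t) (+ t) + + n                ∎
      where
        open ≡-Reasoning
        ≢ₙ-letter : ∀ e → 0 ℕ.< e → e ℕ.< n → ¬ + t + + n ≡ₙ + (t ℕ.+ e)
        ≢ₙ-letter e 0<e e<n t+n≡t+e =
          ≢ₙ-near (ℕ.m<m+n t 0<e) (ℕ.+-monoʳ-< t e<n) (≡ₙ-trans (≡ₙ-sym t+n≡t+e) (≡ₙ-+n (+ t)))
        ≢ₙ-first : ∀ i → i ℕ.< k → ¬ + t + + n ≡ₙ + (suc t ℕ.+ i)
        ≢ₙ-first i i<k = subst (λ p → ¬ + t + + n ≡ₙ + p) (ℕ.+-suc t i) (≢ₙ-letter (suc i) z<s (s≤s (s≤s (ℕ.<⇒≤ i<k))))
        ≢ₙ-second : ∀ i → i ℕ.< k → ¬ + t + + n ≡ₙ + suc (suc t ℕ.+ i)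
        ≢ₙ-second i i<k = subst (λ p → ¬ + t + + n ≡ₙ + p) (trans (ℕ.+-suc t (suc i)) (cong suc (ℕ.+-suc t i)))
                                (≢ₙ-letter (suc (suc i)) z<s (s≤s (s≤s i<k)))

    horiz-kept : ∀ t → kept xs t ≡ true → horiz (suc t) ≡ horiz t
    horiz-kept t kt = trans (prefix-suc-at (+ suc t) kt) (cong (prefix t) (sref-self-suc t))

    horiz-skipped : ∀ t → kept xs t ≡ false → horiz (suc t) ≡ vert t
    horiz-skipped t = prefix-suc-at (+ suc t)

    vert-kept : ∀ t → kept xs t ≡ true → vert (t ℕ.+ m) ≡ vert t + + n
    vert-kept t kt = trans (vert-below t) (cong (_+ + n) (trans (prefix-suc-at (+ t) kt) (cong (prefix t) (sref-self t))))

    vert-skipped : ∀ t → kept xs t ≡ false → vert (t ℕ.+ m) ≡ horiz t + + n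
    vert-skipped t ks = trans (vert-below t) (cong (_+ + n) (prefix-suc-at (+ t) ks))

    vert-top : ∀ c → c ℕ.< m → vert c ≡ + suc c
    vert-top c c<m = prefix-fixes 0 c (λ i i<c → letter-away (kept xs i)
      (≢ₙ-near (ℕ.m<n⇒m<1+n i<c) (ℕ.<-≤-trans (s≤s c<m) (ℕ.m≤n+m n i)))
      (≢ₙ-near (s≤s i<c) (ℕ.<-≤-trans (s≤s c<m) (ℕ.m≤n+m n (suc i)))))

    vert-bottom : length xs ≡ N → (∀ x → prefix N x ≡ x) → ∀ c → vert (N ℕ.+ c) ≡ + suc (N ℕ.+ c)
    vert-bottom |xs|≡N identity c = trans (prefix-fixes N c beyond) (identity _)
      where
        beyond : ∀ i → i ℕ.< c → letter (N ℕ.+ i) (kept xs (N ℕ.+ i)) (+ suc (N ℕ.+ c)) ≡ + suc (N ℕ.+ c)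
        beyond i _ = cong (λ b → letter (N ℕ.+ i) b (+ suc (N ℕ.+ c)))
                          (kept-beyond xs (ℕ.≤-trans (ℕ.≤-reflexive |xs|≡N) (ℕ.m≤m+n N i)))

    vert≢horiz+n : ∀ t → vert t ≢ horiz t + + n
    vert≢horiz+n t vert≡horiz+n = ℕ.m+1+n≢m t (sym (ℕ.suc-injective (trans 1+t≡t+n (ℕ.+-suc t (suc k)))))
      where
        1+t≡t+n : suc t ≡ t ℕ.+ n
        1+t≡t+n = +-injective (prefix-injective t (trans vert≡horiz+n (sym (prefix-+n t (+ t)))))

  prefix-wiring : (u : Vec Bool N) → InS n u → Wiring
  prefix-wiring u (skips≡ , identity) = record
    { kept          = kept xs
    ; horiz         = horiz xs
    ; vert          = vert xs
    ; horiz-zero    = refl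
    ; horiz-end     = identity (+ N)
    ; horiz-kept    = horiz-kept xs
    ; horiz-skipped = horiz-skipped xs
    ; vert-kept     = vert-kept xs
    ; vert-skipped  = vert-skipped xs
    ; vert-top      = vert-top xs
    ; vert-bottom   = vert-bottom xs (length-toList u) identity
    ; vert≢horiz+n  = vert≢horiz+n xs
    ; skip-count    = begin
        #false (kept xs) N             ≡⟨ cong (#false (kept xs)) (length-toList u) ⟨
        #false (kept xs) (length xs)   ≡⟨ skips≡#false xs ⟨
        skips xs                       ≡⟨ skips≡ ⟩
        2 ℕ.* n ℕ.∸ 2                  ≡⟨ ℕ.*-distribˡ-∸ 2 n 1 ⟨
        2 ℕ.* m                        ≡⟨ ℕ.*-comm 2 m ⟩
        m ℕ.* 2                        ∎
    }
    where
      open ≡-Reasoning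
      xs : List Bool
      xs = toList u

open import Data.Nat using (ℕ; _≤_; _*_; _∸_; suc; s≤s; z≤n)
open import Data.Fin using (Fin; toℕ; zero; suc)
open import Data.Fin.Properties using (toℕ<n)
open import Data.Bool using (Bool; true; false)
open import Data.List using (List)
open import Data.Vec using (Vec; lookup; toList; _∷_)
open import Data.Empty using (⊥-elim)
open import Relation.Binary.PropositionalEquality using (_≡_; refl; sym; trans)
open import Function using (_∘_)

lookup≡kept : ∀ {L} (u : Vec Bool L) (j : Fin L) → lookup u j ≡ kept (toList u) (toℕ j)
lookup≡kept (b ∷ u) zero    = refl
lookup≡kept (b ∷ u) (suc j) = lookup≡kept u j

corollary5p15 : (n : ℕ) → 2 ≤ n → (u : Vec Bool (n * (n ∸ 1))) → InS n u
    → (j : Fin (n * (n ∸ 1)))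
    → (prefixProd n u (toℕ j) ∘ sref n (toℕ j)) <ℓ[ n ] prefixProd n u (toℕ j)
    → lookup u j ≡ true
corollary5p15 (suc (suc k)) (s≤s (s≤s z≤n)) u u∈S j shorter with lookup u j in uⱼ
... | true  = refl
... | false = ⊥-elim (ascent⇒¬shorter (prefix xs t) t (skipped⇒ascent (prefix-wiring u u∈S) (toℕ<n j) skipped) shorter)
  where
    open Reflections k using (ascent⇒¬shorter)
    open Grid k using (skipped⇒ascent)
    open Prefixes k using (prefix; prefix-wiring)
    xs : List Bool
    xs = toList u
    t : ℕ
    t = toℕ j
    skipped : kept xs t ≡ false
    skipped = trans (sym (lookup≡kept u j)) uⱼ
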